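{- Let $\mathcal T$ be a tangle of order $k$ in a connectivity system $(E,\lambda)$, and let $(A,B)$ and $(C,D)$ be two non-sequential $k$-separations of $\lambda$. Then $(A,B)$ is $\mathcal T$-equivalent to $(C,D)$ if and only if either $\mathrm{fcl}_{\mathcal T}(A)=\mathrm{fcl}_{\mathcal T}(C)$ or $\mathrm{fcl}_{\mathcal T}(A)=\mathrm{fcl}_{\mathcal T}(D)$.
   Context: A connectivity system is a pair $(E,\lambda)$ with $E$ finite and $\lambda$ an integer-valued symmetric ($\lambda(X)=\lambda(E-X)$) submodular function on subsets of $E$. $X$ is $k$-separating if $\lambda(X)\le k$; a $k$-separation is an unordered partition $(X,E-X)$ (parts may be empty) with $\lambda(X)\le k$. A tangle of order $k$ is a collection $\mathcal T$ of subsets of $E$ with (T1) $\lambda(A)<k$ for $A\in\mathcal T$; (T2) if $\lambda(A)\le k-1$ then $A\in\mathcal T$ or $E-A\in\mathcal T$; (T3) no three members have union $E$; (T4) $E-\{e\}\notin\mathcal T$. $X$ is $\mathcal T$-weak if contained in a member of $\mathcal T$, else $\mathcal T$-strong; a $k$-separation is $\mathcal T$-strong if both sides are. A $\mathcal T$-strong $k$-separating $X$ is fully closed if no non-empty $\mathcal T$-weak $Y\subseteq E-X$ has $X\cup Y$ $k$-separating; $\mathrm{fcl}_{\mathcal T}(X)$ is the intersection of all fully closed $k$-separating sets containing $X$. $\mathcal T$-strong $k$-separations $(X,Y),(X',Y')$ are $\mathcal T$-equivalent if $\{\mathrm{fcl}_{\mathcal T}(X),\mathrm{fcl}_{\mathcal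 T}(Y)\}=\{\mathrm{fcl}_{\mathcal T}(X'),\mathrm{fcl}_{\mathcal T}(Y')\}$. A $k$-separating set $X$ is $\mathcal T$-sequential if $E-X$ is $\mathcal T$-strong and $\mathrm{fcl}_{\mathcal T}(E-X)=E$; a $k$-separation $(X,Y)$ is non-sequential if neither $X$ nor $Y$ is $\mathcal T$-sequential (such a $k$-separation is necessarily $\mathcal T$-strong). -}

module Defs where

open import Data.Nat using (ℕ)
open import Data.Integer using (ℤ; _+_; _-_; _≤_; _<_; 1ℤ)
open import Data.Fin using (Fin)
open import Data.Fin.Subset using (Subset; _∈_; _⊆_; ∁; _∩_; _∪_; ⊤; ⁅_⁆; Nonempty)
open import Data.Product using (Σ; ∃; _×_)
open import Data.Sum using (_⊎_)
open import Relation.Nullary using (¬_)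
open import Relation.Binary.PropositionalEquality using (_≡_)

record ConnectivitySystem (n : ℕ) : Set where
  field
    conn        : Subset n → ℤ
    symmetric   : ∀ X → conn X ≡ conn (∁ X)
    submodular  : ∀ X Y → conn (X ∪ Y) + conn (X ∩ Y) ≤ conn X + conn Y

module _ {n : ℕ} (S : ConnectivitySystem n) where
  open ConnectivitySystem S

  KSeparating : ℤ → Subset n → Set
  KSeparating k X = conn X ≤ k

  KSeparation : ℤ → Subset n → Subset n → Set
  KSeparation k X Y = (Y ≡ ∁ X) × KSeparating k X

  record IsTangle (k : ℤ) (T : Subset n → Set) : Set where
    field
      T1 : ∀ A → T A → conn A < k
      T2 : ∀ A → conn A ≤ k - 1ℤ → T A ⊎ T (∁ A)
      T3 : ∀ A B C → T A → T B → T C → ¬ ((A ∪ B) ∪ C ≡ ⊤)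
      T4 : ∀ e → ¬ T (∁ ⁅ e ⁆)

  module _ (k : ℤ) (T : Subset n → Set) where

    Weak : Subset n → Set
    Weak X = ∃ λ A → T A × X ⊆ A

    Strong : Subset n → Set
    Strong X = ¬ Weak X

    FullyClosed : Subset n → Set
    FullyClosed X =
      Strong X × KSeparating k X ×
      (∀ Y → Nonempty Y → Weak Y → Y ⊆ ∁ X → ¬ KSeparating k (X ∪ Y))

    InFcl : Subset n → Fin n → Set
    InFcl X x = ∀ F → FullyClosed F → X ⊆ F → x ∈ F

    FclEq : Subset n → Subset n → Set
    FclEq X Y = ∀ x → (InFcl X x → InFcl Y x) × (InFcl Y x → InFcl X x)

    -- {fcl X, fcl Y} = {fcl X', fcl Y'} as unordered pairs
    TEquivalent : Subset n → Subset n → Subset n → Subset n → Set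
    TEquivalent X Y X' Y' =
      (FclEq X X' × FclEq Y Y') ⊎ (FclEq X Y' × FclEq Y X')

    Sequential : Subset n → Set
    Sequential X = KSeparating k X × Strong (∁ X) × (∀ x → InFcl (∁ X) x)

    NonSequential : Subset n → Subset n → Set
    NonSequential X Y = KSeparation k X Y × ¬ Sequential X × ¬ Sequential Y

-- For the converse
-- it suffices to show: if (A,∁A) and (C,∁C) are non-sequential and
-- fcl(A) = fcl(C), then fcl(∁A) = fcl(∁C); the case fcl(A) = fcl(D) is the
-- same statement applied to the swapped separation (D,C).
--
-- Let Z be a fully closed set with Z ≠ E
-- and G any fully closed set.  Strong subsets of Z have connectivity at
-- least k, so submodularity lets us uncross with Z and with ∁G.  From this,
-- for X ⊆ Z strong and k-separating with ∁G ⊆ fcl(X), we get ∁G ⊆ X, by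
-- induction on n - |X|: either X is itself fully closed, or X extends by a
-- weak set Y to a larger such set X ∪ Y ⊆ Z, and ∁G ⊆ X ∪ Y descends to
-- ∁G ⊆ X.  Applied to X = A (and Z ranging over the fully closed sets
-- containing A, which exist since fcl(A) ≠ E) this shows that every fully
-- closed G ⊇ ∁C contains ∁A, i.e. fcl(∁A) ⊆ fcl(∁C).
module Submission where

open import Defs
open import Data.Nat using (ℕ)
open import Data.Integer using (ℤ)
open import Data.Fin.Subset using (Subset)
open import Data.Product using (_×_)
open import Data.Sum using (_⊎_)

import Data.Nat as ℕ
import Data.Nat.Properties as ℕ
open import Data.Nat.Induction using (<-wellFounded)
open import Data.Integer using (_+_; _-_; 1ℤ; -1ℤ; _≤_; _<_; _≤?_)
open import Data.Integer.Properties
  using (≤-trans; ≰⇒>; <⇒≱; +-mono-<-≤; +-mono-<; +-mono-≤; +-comm; i<j⇒i≤pred[j])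
open import Data.Fin using (Fin)
open import Data.Fin.Subset using (_∈_; _∉_; _⊆_; _⊂_; ∁; _∩_; _∪_; ⊤; Nonempty; ∣_∣) renaming (⊥ to ∅)
open import Data.Fin.Subset.Properties
  using ( _∈?_; ⊆-refl; ⊆-trans; ⊆-antisym; p⊆p∪q; q⊆p∪q; x∈p∪q⁻; x∈p∩q⁺; x∈p∩q⁻; p∩q⊆p; p∩q⊆q
        ; x∈∁p⇒x∉p; x∉p⇒x∈∁p; x∉∁p⇒x∈p; p⊆q⇒∁p⊇∁q; p∪∁p≡⊤
        ; ∈⊤; ∩-inverseʳ; ∩-identityʳ; ∪-inverseʳ; ∪-distribˡ-∩; ∩-comm
        ; p⊂q⇒∣p∣<∣q∣; ∣p∣≤n; ∪-∩-booleanAlgebra )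
import Algebra.Lattice.Properties.BooleanAlgebra as BooleanAlgebraProperties
open import Data.Product using (_,_; proj₁; proj₂)
open import Data.Sum using (inj₁; inj₂)
open import Data.Empty using (⊥; ⊥-elim)
open import Induction.WellFounded using (Acc; acc)
open import Relation.Nullary using (¬_; yes; no; contradiction)
open import Relation.Binary.PropositionalEquality using (_≡_; refl; sym; trans; cong; cong₂; subst)
open Relation.Binary.PropositionalEquality.≡-Reasoning

+-cancel-≤ : ∀ {a b c d} → a + b ≤ c + d → d ≤ b → a ≤ c
+-cancel-≤ {a} {b} {c} {d} a+b≤c+d d≤b with a ≤? c
... | yes a≤c = a≤c
... | no a≰c = contradiction a+b≤c+d (<⇒≱ (+-mono-<-≤ (≰⇒> a≰c) d≤b))

halve-≤ : ∀ {a b} → a + a ≤ b + b → a ≤ b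
halve-≤ {a} {b} a+a≤b+b with a ≤? b
... | yes a≤b = a≤b
... | no a≰b = contradiction a+a≤b+b (<⇒≱ (+-mono-< (≰⇒> a≰b) (≰⇒> a≰b)))

<⇒≤-1 : ∀ {a k} → a < k → a ≤ k - 1ℤ
<⇒≤-1 {a} {k} a<k = subst (a ≤_) (+-comm -1ℤ k) (i<j⇒i≤pred[j] a<k)

module SubsetAlgebra {n : ℕ} where
  open BooleanAlgebraProperties (∪-∩-booleanAlgebra n) using (¬-involutive; deMorgan₁; ¬⊥≈⊤)

  ∁-involutive : (P : Subset n) → ∁ (∁ P) ≡ P
  ∁-involutive = ¬-involutive

  ∁∅≡⊤ : ∁ (∅ {n}) ≡ ⊤
  ∁∅≡⊤ = ¬⊥≈⊤

  ∪-∖ : (F Y : Subset n) → F ∪ (Y ∩ ∁ F) ≡ F ∪ Y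
  ∪-∖ F Y = begin
    F ∪ (Y ∩ ∁ F)           ≡⟨ ∪-distribˡ-∩ F Y (∁ F) ⟩
    (F ∪ Y) ∩ (F ∪ ∁ F)     ≡⟨ cong ((F ∪ Y) ∩_) (∪-inverseʳ F) ⟩
    (F ∪ Y) ∩ ⊤             ≡⟨ ∩-identityʳ (F ∪ Y) ⟩
    F ∪ Y                   ∎

  ∁-∁∩ : (G X : Subset n) → ∁ (∁ G ∩ X) ≡ G ∪ ∁ X
  ∁-∁∩ G X = trans (deMorgan₁ (∁ G) X) (cong (_∪ ∁ X) (∁-involutive G))

  ∁-⊆-swap : ∀ {P Q : Subset n} → ∁ P ⊆ Q → ∁ Q ⊆ P
  ∁-⊆-swap ∁P⊆Q x∈∁Q = x∉∁p⇒x∈p λ x∈∁P → x∈∁p⇒x∉p x∈∁Q (∁P⊆Q x∈∁P)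

  outside-⊆ : ∀ {P Q X Y : Subset n} → P ⊆ X ∪ Y → X ⊆ Q → P ∩ ∁ Q ⊆ Y
  outside-⊆ {P} {Q} {X} {Y} P⊆X∪Y X⊆Q x∈P∖Q with x∈p∩q⁻ P (∁ Q) x∈P∖Q
  ... | x∈P , x∈∁Q with x∈p∪q⁻ X Y (P⊆X∪Y x∈P)
  ...   | inj₁ x∈X = ⊥-elim (x∈∁p⇒x∉p x∈∁Q (X⊆Q x∈X))
  ...   | inj₂ x∈Y = x∈Y

  ⊂⇒∸-< : ∀ {X X′ : Subset n} → X ⊂ X′ → n ℕ.∸ ∣ X′ ∣ ℕ.< n ℕ.∸ ∣ X ∣
  ⊂⇒∸-< {X} {X′} X⊂X′ = ℕ.∸-monoʳ-< (p⊂q⇒∣p∣<∣q∣ X⊂X′) (∣p∣≤n X′)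

open SubsetAlgebra

module Connectivity {n : ℕ} (S : ConnectivitySystem n) (k : ℤ) where
  open ConnectivitySystem S

  KSep : Subset n → Set
  KSep = KSeparating S k

  -- The ground set has the least connectivity: λ(E) + λ(∅) ≤ λ(X) + λ(∁X).
  conn-⊤-least : ∀ X → conn ⊤ ≤ conn X
  conn-⊤-least X = halve-≤ (subst (λ v → v ≤ conn X + conn X) sides sub)
    where
    sub : conn (X ∪ ∁ X) + conn (X ∩ ∁ X) ≤ conn X + conn X
    sub = subst (λ v → conn (X ∪ ∁ X) + conn (X ∩ ∁ X) ≤ conn X + v)
                (sym (symmetric X)) (submodular X (∁ X))
    ∩-side : conn (X ∩ ∁ X) ≡ conn ⊤
    ∩-side = begin
      conn (X ∩ ∁ X)  ≡⟨ cong conn (∩-inverseʳ X) ⟩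
      conn ∅          ≡⟨ symmetric ∅ ⟩
      conn (∁ ∅)      ≡⟨ cong conn ∁∅≡⊤ ⟩
      conn ⊤          ∎
    sides : conn (X ∪ ∁ X) + conn (X ∩ ∁ X) ≡ conn ⊤ + conn ⊤
    sides = cong₂ _+_ (cong conn (p∪∁p≡⊤ X)) ∩-side

  ⊤-kSep : ∀ {X} → KSep X → KSep ⊤
  ⊤-kSep {X} = ≤-trans (conn-⊤-least X)

  ∁-kSep : ∀ {X} → KSep X → KSep (∁ X)
  ∁-kSep {X} = subst (_≤ k) (symmetric X)

  uncross-∪ : ∀ {P Q} → KSep P → KSep Q → k ≤ conn (P ∩ Q) → KSep (P ∪ Q)
  uncross-∪ {P} {Q} ksP ksQ k≤∩ =
    +-cancel-≤ (≤-trans (submodular P Q) (+-mono-≤ ksP ksQ)) k≤∩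

  uncross-∩ : ∀ {P Q} → KSep P → KSep Q → k ≤ conn (P ∪ Q) → KSep (P ∩ Q)
  uncross-∩ {P} {Q} ksP ksQ k≤∪ =
    +-cancel-≤ (subst (_≤ k + k) (+-comm (conn (P ∪ Q)) (conn (P ∩ Q)))
                      (≤-trans (submodular P Q) (+-mono-≤ ksP ksQ))) k≤∪

module Closure {n : ℕ} (S : ConnectivitySystem n) (k : ℤ) (T : Subset n → Set) where
  open Connectivity S k public

  IsWeak IsStrong IsFullyClosed : Subset n → Set
  IsWeak = Weak S k T
  IsStrong = Strong S k T
  IsFullyClosed = FullyClosed S k T

  _∈fcl_ : Fin n → Subset n → Set
  x ∈fcl X = InFcl S k T X x

  _⊆fcl_ : Subset n → Subset n → Set
  P ⊆fcl X = ∀ {x} → x ∈ P → x ∈fcl X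

  weak-⊆ : ∀ {X Y} → Y ⊆ X → IsWeak X → IsWeak Y
  weak-⊆ Y⊆X (A , tA , X⊆A) = A , tA , λ y → X⊆A (Y⊆X y)

  strong-⊇ : ∀ {X Y} → X ⊆ Y → IsStrong X → IsStrong Y
  strong-⊇ X⊆Y stX wY = stX (weak-⊆ X⊆Y wY)

  fcl-extensive : ∀ {X} → X ⊆fcl X
  fcl-extensive x∈X F _ X⊆F = X⊆F x∈X

  fcl-mono : ∀ {X X′} → X ⊆ X′ → ∀ {x} → x ∈fcl X → x ∈fcl X′
  fcl-mono X⊆X′ x∈fclX F fcF X′⊆F = x∈fclX F fcF (⊆-trans X⊆X′ X′⊆F)

  fcl-full : ∀ {A} → (∀ {Z x₀} → IsFullyClosed Z → x₀ ∉ Z → A ⊆ Z → ⊥) → ∀ x → x ∈fcl A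
  fcl-full none x F fcF A⊆F with x ∈? F
  ... | yes x∈F = x∈F
  ... | no x∉F = ⊥-elim (none fcF x∉F A⊆F)

  nonSequential-swap : ∀ {A B} → NonSequential S k T A B → NonSequential S k T B A
  nonSequential-swap {A} ((refl , ksA) , ¬seqA , ¬seq∁A) =
    (sym (∁-involutive A) , ∁-kSep ksA) , ¬seq∁A , ¬seqA

  fullyClosed-absorbs : ∀ {F Y} → IsFullyClosed F → IsWeak (Y ∩ ∁ F) → KSep (F ∪ Y) → Y ⊆ F
  fullyClosed-absorbs {F} {Y} (_ , _ , closed) wY∖F ksF∪Y {y} y∈Y with y ∈? F
  ... | yes y∈F = y∈F
  ... | no y∉F = ⊥-elim (closed (Y ∩ ∁ F) (y , x∈p∩q⁺ (y∈Y , x∉p⇒x∈∁p y∉F)) wY∖F (p∩q⊆q Y (∁ F))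
                        (subst KSep (sym (∪-∖ F Y)) ksF∪Y))

  fullyClosed-coweak : ∀ {F} → IsFullyClosed F → IsWeak (∁ F) → ∀ x → x ∈ F
  fullyClosed-coweak {F} fcF w∁F x = x∉∁p⇒x∈p λ x∈∁F → x∈∁p⇒x∉p x∈∁F (∁F⊆F x∈∁F)
    where
    ∁F⊆F : ∁ F ⊆ F
    ∁F⊆F = fullyClosed-absorbs fcF (weak-⊆ (p∩q⊆q (∁ F) (∁ F)) w∁F)
             (subst KSep (sym (p∪∁p≡⊤ F)) (⊤-kSep (proj₁ (proj₂ fcF))))

module TangleClosure {n : ℕ} (S : ConnectivitySystem n) (k : ℤ) (T : Subset n → Set)
                     (tangle : IsTangle S k T) where
  open ConnectivitySystem S
  open IsTangle tangle
  open Closure S k T public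

  ∁-weak-strong : ∀ {X} → IsWeak X → IsStrong (∁ X)
  ∁-weak-strong {X} (A₁ , t₁ , X⊆A₁) (A₂ , t₂ , ∁X⊆A₂) = T3 A₁ A₂ A₂ t₁ t₂ t₂ (⊆-antisym (λ _ → ∈⊤) covers)
    where
    covers : ⊤ ⊆ (A₁ ∪ A₂) ∪ A₂
    covers {x} _ with x ∈? X
    ... | yes x∈X = p⊆p∪q A₂ (p⊆p∪q A₂ (X⊆A₁ x∈X))
    ... | no x∉X = q⊆p∪q (A₁ ∪ A₂) A₂ (∁X⊆A₂ (x∉p⇒x∈∁p x∉X))

  -- Weak k-separating sets are sequential; so both sides of a
  -- non-sequential separation are strong.
  weak-sequential : ∀ {X} → KSep X → IsWeak X → Sequential S k T X
  weak-sequential {X} ksX wX = ksX , ∁-weak-strong wX , fcl∁X-full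
    where
    fcl∁X-full : ∀ x → x ∈fcl ∁ X
    fcl∁X-full x F fcF ∁X⊆F = fullyClosed-coweak fcF (weak-⊆ (∁-⊆-swap ∁X⊆F) wX) x

  strong-in-proper : ∀ {Z x₀ V} → IsFullyClosed Z → x₀ ∉ Z → V ⊆ Z → IsStrong V → k ≤ conn V
  strong-in-proper {Z} {x₀} {V} fcZ x₀∉Z V⊆Z stV with k ≤? conn V
  ... | yes k≤V = k≤V
  ... | no k≰V with T2 V (<⇒≤-1 (≰⇒> k≰V))
  ...   | inj₁ tV = ⊥-elim (stV (V , tV , ⊆-refl))
  ...   | inj₂ t∁V = ⊥-elim (x₀∉Z (fullyClosed-coweak fcZ (∁ V , t∁V , p⊆q⇒∁p⊇∁q V⊆Z) x₀))

  -- A proper fully closed Z containing a strong X absorbs every weak Y for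
  -- which X ∪ Y is k-separating (uncross Z with X ∪ Y).
  weak-extension-inside : ∀ {Z x₀ X Y} → IsFullyClosed Z → x₀ ∉ Z → X ⊆ Z → IsStrong X →
                          IsWeak Y → KSep (X ∪ Y) → X ∪ Y ⊆ Z
  weak-extension-inside {Z} {x₀} {X} {Y} fcZ x₀∉Z X⊆Z stX wY ksX∪Y =
    fullyClosed-absorbs fcZ (weak-⊆ (outside-⊆ ⊆-refl X⊆Z) wY) (uncross-∪ (proj₁ (proj₂ fcZ)) ksX∪Y k≤Z∩X∪Y)
    where
    X⊆Z∩X∪Y : X ⊆ Z ∩ (X ∪ Y)
    X⊆Z∩X∪Y x∈X = x∈p∩q⁺ (X⊆Z x∈X , p⊆p∪q Y x∈X)
    k≤Z∩X∪Y : k ≤ conn (Z ∩ (X ∪ Y))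
    k≤Z∩X∪Y = strong-in-proper fcZ x₀∉Z (p∩q⊆p Z (X ∪ Y)) (strong-⊇ X⊆Z∩X∪Y stX)

  -- Uncrossing with ∁G: if ∁G and X lie in a proper fully closed Z, X is
  -- strong and k-separating, and ∁G ∖ X is weak, then ∁G ⊆ X.
  complement-shrinks : ∀ {Z x₀ G X} → IsFullyClosed Z → x₀ ∉ Z → IsFullyClosed G →
                       ∁ G ⊆ Z → X ⊆ Z → IsStrong X → KSep X → IsWeak (∁ G ∩ ∁ X) → ∁ G ⊆ X
  complement-shrinks {Z} {x₀} {G} {X} fcZ x₀∉Z fcG ∁G⊆Z X⊆Z stX ksX w∁G∖X =
    ∁-⊆-swap (fullyClosed-absorbs fcG (subst IsWeak (∩-comm (∁ G) (∁ X)) w∁G∖X)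
                                      (subst KSep (∁-∁∩ G X) (∁-kSep ks∁G∩X)))
    where
    ∁G∪X⊆Z : ∁ G ∪ X ⊆ Z
    ∁G∪X⊆Z x∈ with x∈p∪q⁻ (∁ G) X x∈
    ... | inj₁ x∈∁G = ∁G⊆Z x∈∁G
    ... | inj₂ x∈X = X⊆Z x∈X
    ks∁G∩X : KSep (∁ G ∩ X)
    ks∁G∩X = uncross-∩ (∁-kSep (proj₁ (proj₂ fcG))) ksX
               (strong-in-proper fcZ x₀∉Z ∁G∪X⊆Z (strong-⊇ (q⊆p∪q (∁ G) X) stX))

  -- If g ∈ ∁G ∖ X,
  -- then X is fully closed (contradicting g ∈ fcl(X)): a weak extension
  -- X ∪ Y stays inside Z and is strictly larger, so by induction on n - |X|
  -- ∁G ⊆ X ∪ Y, which complement-shrinks turns into g ∈ ∁G ⊆ X.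
  descent : ∀ {Z x₀ G} → IsFullyClosed Z → x₀ ∉ Z → IsFullyClosed G →
            ∀ X → Acc ℕ._<_ (n ℕ.∸ ∣ X ∣) → X ⊆ Z → IsStrong X → KSep X → ∁ G ⊆fcl X → ∁ G ⊆ X
  descent {Z} {x₀} {G} fcZ x₀∉Z fcG X (acc smaller) X⊆Z stX ksX ∁G⊆fclX {g} g∈∁G with g ∈? X
  ... | yes g∈X = g∈X
  ... | no g∉X = ⊥-elim (g∉X (∁G⊆fclX g∈∁G X X-fullyClosed ⊆-refl))
    where
    no-weak-extension : ∀ Y → Nonempty Y → IsWeak Y → Y ⊆ ∁ X → ¬ KSep (X ∪ Y)
    no-weak-extension Y (y , y∈Y) wY Y⊆∁X ksX∪Y =
      g∉X (complement-shrinks fcZ x₀∉Z fcG (⊆-trans ∁G⊆X∪Y X∪Y⊆Z) X⊆Z stX ksX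
             (weak-⊆ (outside-⊆ ∁G⊆X∪Y ⊆-refl) wY) g∈∁G)
      where
      X∪Y⊆Z : X ∪ Y ⊆ Z
      X∪Y⊆Z = weak-extension-inside fcZ x₀∉Z X⊆Z stX wY ksX∪Y
      X⊂X∪Y : X ⊂ X ∪ Y
      X⊂X∪Y = p⊆p∪q Y , y , q⊆p∪q X Y y∈Y , x∈∁p⇒x∉p (Y⊆∁X y∈Y)
      ∁G⊆X∪Y : ∁ G ⊆ X ∪ Y
      ∁G⊆X∪Y = descent fcZ x₀∉Z fcG (X ∪ Y) (smaller (⊂⇒∸-< X⊂X∪Y)) X∪Y⊆Z
                 (strong-⊇ (p⊆p∪q Y) stX) ksX∪Y (λ g∈∁G → fcl-mono (p⊆p∪q Y) (∁G⊆fclX g∈∁G))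
    X-fullyClosed : IsFullyClosed X
    X-fullyClosed = stX , ksX , no-weak-extension

  NonSequentialSide : Subset n → Set
  NonSequentialSide X = IsStrong X × KSep X × ¬ (∀ x → x ∈fcl X)

  nonSequential-side : ∀ {A B} → NonSequential S k T A B → NonSequentialSide A
  nonSequential-side {A} ((refl , ksA) , ¬seqA , ¬seq∁A) = stA , ksA , fclA≠E
    where
    stA : IsStrong A
    stA wA = ¬seqA (weak-sequential ksA wA)
    fclA≠E : ¬ (∀ x → x ∈fcl A)
    fclA≠E fclA=E = ¬seq∁A (∁-kSep ksA , subst (λ P → IsStrong P × (∀ x → x ∈fcl P))
                                                 (sym (∁-involutive A)) (stA , fclA=E))

  -- If A is a non-sequential side and C ⊆ fcl(A), then fcl(∁A) ⊆ fcl(∁C):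
  -- a fully closed G ⊇ ∁C missing a point of fcl(∁A) would, by descent,
  -- exclude every proper fully closed set containing A, forcing fcl(A) = E.
  fcl-∁-antitone : ∀ {A C} → NonSequentialSide A → C ⊆fcl A → ∀ {x} → x ∈fcl ∁ A → x ∈fcl ∁ C
  fcl-∁-antitone {A} {C} (stA , ksA , fclA≠E) C⊆fclA {x} x∈fcl∁A G fcG ∁C⊆G with x ∈? G
  ... | yes x∈G = x∈G
  ... | no x∉G = ⊥-elim (fclA≠E (fcl-full no-proper-closure))
    where
    no-proper-closure : ∀ {Z x₀} → IsFullyClosed Z → x₀ ∉ Z → A ⊆ Z → ⊥
    no-proper-closure fcZ x₀∉Z A⊆Z = x∉G (x∈fcl∁A G fcG (∁-⊆-swap ∁G⊆A))
      where
      ∁G⊆A : ∁ G ⊆ A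
      ∁G⊆A = descent fcZ x₀∉Z fcG A (<-wellFounded _) A⊆Z stA ksA
               (λ g∈∁G → C⊆fclA (∁-⊆-swap ∁C⊆G g∈∁G))

  complementary-fclEq : ∀ {A B C D} → NonSequential S k T A B → NonSequential S k T C D →
                        FclEq S k T A C → FclEq S k T B D
  complementary-fclEq nsAB@((refl , _) , _) nsCD@((refl , _) , _) fclA=fclC x =
    fcl-∁-antitone (nonSequential-side nsAB) (λ c∈C → proj₂ (fclA=fclC _) (fcl-extensive c∈C)) ,
    fcl-∁-antitone (nonSequential-side nsCD) (λ a∈A → proj₁ (fclA=fclC _) (fcl-extensive a∈A))

lemma3p7 : (n : ℕ) (S : ConnectivitySystem n) (k : ℤ) (T : Subset n → Set) →
    IsTangle S k T →
    (A B C D : Subset n) →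
    NonSequential S k T A B → NonSequential S k T C D →
    (TEquivalent S k T A B C D → FclEq S k T A C ⊎ FclEq S k T A D) ×
    (FclEq S k T A C ⊎ FclEq S k T A D → TEquivalent S k T A B C D)
lemma3p7 n S k T tangle A B C D nsAB nsCD = forward , backward
  where
  open TangleClosure S k T tangle
  forward : TEquivalent S k T A B C D → FclEq S k T A C ⊎ FclEq S k T A D
  forward (inj₁ (fclA=fclC , _)) = inj₁ fclA=fclC
  forward (inj₂ (fclA=fclD , _)) = inj₂ fclA=fclD
  backward : FclEq S k T A C ⊎ FclEq S k T A D → TEquivalent S k T A B C D
  backward (inj₁ fclA=fclC) = inj₁ (fclA=fclC , complementary-fclEq nsAB nsCD fclA=fclC)
  backward (inj₂ fclA=fclD) = inj₂ (fclA=fclD , complementary-fclEq nsAB (nonSequential-swap nsCD) fclA=fclD)
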